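{- Let $\Sigma_r=\{0,1,-,+,\cdot\}$ (constants $0,1$, unary minus $-$, binary $+$ and $\cdot$). The term rewriting system $D_1$ obtained by orienting the following twelve equations from left to right is ground-complete: [R1] $x+0=x$; [R2] $0+x=x$; [R3] $x+(y+z)=(x+y)+z$; [R4] $x\cdot 0=0$; [R5] $x\cdot 1=x$; [R6] $x\cdot(y+z)=(x\cdot y)+(x\cdot z)$; [R7] $-0=0$; [R8] $(-1)+1=0$; [R9] $(-(x+1))+1=-x$; [R10] $-(-x)=x$; [R11] $x+(-y)=-((-x)+y)$; [R12] $x\cdot(-y)=-(x\cdot y)$.
   Context: Each equation is read as a rewrite rule from left to right, where $x,y,z$ are variables. A term rewriting system is ground-complete if it is strongly terminating (no infinite rewrite sequences) and ground-confluent (confluent on closed terms), so that every closed term has a unique normal form. In this paper, $D_1$ is intended as a specification of the ring of integers with normal forms $0$, the positive numerals $1$ and $t+1$ ($t$ a positive numeral), and $-t$ for $t$ a positive numeral. -}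

module Defs where

open import Data.Empty using (⊥)
open import Data.Product using (∃; _×_)
open import Induction.WellFounded using (WellFounded)
open import Relation.Binary.Construct.Closure.ReflexiveTransitive using (Star)

data Term (V : Set) : Set where
  var  : V → Term V
  `0   : Term V
  `1   : Term V
  -_   : Term V → Term V
  _+_  : Term V → Term V → Term V
  _·_  : Term V → Term V → Term V

infixl 6 _+_
infixl 7 _·_
infix  8 -_

data _↦_ {V : Set} : Term V → Term V → Set where
  R1  : ∀ x → x + `0 ↦ x
  R2  : ∀ x → `0 + x ↦ x
  R3  : ∀ x y z → x + (y + z) ↦ (x + y) + z
  R4  : ∀ x → x · `0 ↦ `0
  R5  : ∀ x → x · `1 ↦ x
  R6  : ∀ x y z → x · (y + z) ↦ (x · y) + (x · z)
  R7  : - `0 ↦ `0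
  R8  : (- `1) + `1 ↦ `0
  R9  : ∀ x → (- (x + `1)) + `1 ↦ - x
  R10 : ∀ x → - (- x) ↦ x
  R11 : ∀ x y → x + (- y) ↦ - ((- x) + y)
  R12 : ∀ x y → x · (- y) ↦ - (x · y)

infix 4 _↦_ _⟶_ _⟶*_

data _⟶_ {V : Set} : Term V → Term V → Set where
  root : ∀ {s t} → s ↦ t → s ⟶ t
  neg  : ∀ {s t} → s ⟶ t → - s ⟶ - t
  +ˡ   : ∀ {s t} u → s ⟶ t → s + u ⟶ t + u
  +ʳ   : ∀ {s t} u → s ⟶ t → u + s ⟶ u + t
  ·ˡ   : ∀ {s t} u → s ⟶ t → s · u ⟶ t · u
  ·ʳ   : ∀ {s t} u → s ⟶ t → u · s ⟶ u · t

_⟶*_ : {V : Set} → Term V → Term V → Set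
_⟶*_ = Star _⟶_

StronglyTerminating : Set₁
StronglyTerminating = (V : Set) → WellFounded (λ (u t : Term V) → t ⟶ u)

Closed : Set
Closed = Term ⊥

GroundConfluent : Set
GroundConfluent = ∀ (t u v : Closed) → t ⟶* u → t ⟶* v → ∃ λ w → (u ⟶* w) × (v ⟶* w)

GroundComplete : Set₁
GroundComplete = StronglyTerminating × GroundConfluent

module Submission where

-- Termination: interpret 0, 1 and variables as 0, -x as x + 1, x + y as x + 3y + 7 and
-- x · y as xy + 2x + 2y + 2. These are strictly monotone polynomials on ℕ, and every rule
-- strictly decreases the interpretation, so it bounds the length of any rewrite sequence.
-- Ground confluence: every closed term rewrites to the numeral of its value in ℤ (the rules
-- implement the arithmetic of numerals), while rewriting preserves that value; hence any two
-- reducts of a closed term rewrite to one and the same numeral.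

open import Defs
open import Data.Empty using (⊥)
open import Data.Nat.Base as ℕ using (ℕ; zero; suc; _<_; s≤s; z<s)
open import Data.Nat.Properties as ℕ using ()
open import Data.Nat.Induction using (<-wellFounded)
open import Data.Nat.Tactic.RingSolver using (solve-∀)
open import Data.Integer.Base as ℤ using (ℤ; +0; +[1+_]; -[1+_]; 0ℤ; 1ℤ)
open import Data.Integer.Properties as ℤ using ()
open import Data.Integer.Tactic.RingSolver as ℤ-Solver using ()
open import Data.Product using (_,_)
open import Induction.WellFounded using (module Subrelation)
open import Relation.Binary.Construct.On as On using ()
open import Relation.Binary.Construct.Closure.ReflexiveTransitive using (ε; _◅_; gmap)
open import Relation.Binary.Construct.Closure.ReflexiveTransitive.Properties
  using (module StarReasoning)
open import Relation.Binary.PropositionalEquality using (_≡_; refl; sym; trans; cong)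

infixl 6 _⊕_
infixl 7 _⊗_

_⊕_ : ℕ → ℕ → ℕ
m ⊕ n = m ℕ.+ 3 ℕ.* n ℕ.+ 7

_⊗_ : ℕ → ℕ → ℕ
m ⊗ n = m ℕ.* n ℕ.+ 2 ℕ.* m ℕ.+ 2 ℕ.* n ℕ.+ 2

weight : {V : Set} → Term V → ℕ
weight (var _) = 0
weight `0      = 0
weight `1      = 0
weight (- t)   = suc (weight t)
weight (s + t) = weight s ⊕ weight t
weight (s · t) = weight s ⊗ weight t

⊕-monoˡ-< : ∀ {m m′} n → m < m′ → m ⊕ n < m′ ⊕ n
⊕-monoˡ-< n m<m′ = ℕ.+-monoˡ-< 7 (ℕ.+-monoˡ-< (3 ℕ.* n) m<m′)

⊕-monoʳ-< : ∀ m {n n′} → n < n′ → m ⊕ n < m ⊕ n′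
⊕-monoʳ-< m n<n′ = ℕ.+-monoˡ-< 7 (ℕ.+-monoʳ-< m (ℕ.*-monoʳ-< 3 n<n′))

⊗-monoˡ-< : ∀ {m m′} n → m < m′ → m ⊗ n < m′ ⊗ n
⊗-monoˡ-< n m<m′ = ℕ.+-monoˡ-< 2 (ℕ.+-mono-<-≤
  (ℕ.+-mono-≤-< (ℕ.*-monoˡ-≤ n (ℕ.<⇒≤ m<m′)) (ℕ.*-monoʳ-< 2 m<m′)) ℕ.≤-refl)

⊗-monoʳ-< : ∀ m {n n′} → n < n′ → m ⊗ n < m ⊗ n′
⊗-monoʳ-< m n<n′ = ℕ.+-monoˡ-< 2 (ℕ.+-mono-≤-<
  (ℕ.+-mono-≤ (ℕ.*-monoʳ-≤ m (ℕ.<⇒≤ n<n′)) ℕ.≤-refl) (ℕ.*-monoʳ-< 2 n<n′))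

-- The decreases below exhibit the slack k explicitly, so that what remains is a polynomial
-- identity for the ring solver. Opaque, since otherwise checking ↦-decreases-weight is very slow.
opaque
  n≡1+m+k⇒m<n : ∀ {m n} k → n ≡ suc (m ℕ.+ k) → m < n
  n≡1+m+k⇒m<n {m} k refl = s≤s (ℕ.m≤m+n m k)

m<m⊕0 : ∀ m → m < m ⊕ 0
m<m⊕0 m = n≡1+m+k⇒m<n 6 (identity m)
  where
  identity : ∀ m → m ℕ.+ 3 ℕ.* 0 ℕ.+ 7 ≡ suc (m ℕ.+ 6)
  identity = solve-∀

m<0⊕m : ∀ m → m < 0 ⊕ m
m<0⊕m m = n≡1+m+k⇒m<n (2 ℕ.* m ℕ.+ 6) (identity m)
  where
  identity : ∀ m → 0 ℕ.+ 3 ℕ.* m ℕ.+ 7 ≡ suc (m ℕ.+ (2 ℕ.* m ℕ.+ 6))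
  identity = solve-∀

[m⊕n]⊕o<m⊕[n⊕o] : ∀ m n o → m ⊕ n ⊕ o < m ⊕ (n ⊕ o)
[m⊕n]⊕o<m⊕[n⊕o] m n o = n≡1+m+k⇒m<n (6 ℕ.* o ℕ.+ 13) (identity m n o)
  where
  identity : ∀ m n o → m ℕ.+ 3 ℕ.* (n ℕ.+ 3 ℕ.* o ℕ.+ 7) ℕ.+ 7
                       ≡ suc (m ℕ.+ 3 ℕ.* n ℕ.+ 7 ℕ.+ 3 ℕ.* o ℕ.+ 7 ℕ.+ (6 ℕ.* o ℕ.+ 13))
  identity = solve-∀

m<m⊗0 : ∀ m → m < m ⊗ 0
m<m⊗0 m = n≡1+m+k⇒m<n (m ℕ.+ 1) (identity m)
  where
  identity : ∀ m → m ℕ.* 0 ℕ.+ 2 ℕ.* m ℕ.+ 2 ℕ.* 0 ℕ.+ 2 ≡ suc (m ℕ.+ (m ℕ.+ 1))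
  identity = solve-∀

m⊗n⊕m⊗o<m⊗[n⊕o] : ∀ m n o → m ⊗ n ⊕ m ⊗ o < m ⊗ (n ⊕ o)
m⊗n⊕m⊗o<m⊗[n⊕o] m n o = n≡1+m+k⇒m<n m (identity m n o)
  where
  identity : ∀ m n o → m ℕ.* (n ℕ.+ 3 ℕ.* o ℕ.+ 7) ℕ.+ 2 ℕ.* m ℕ.+ 2 ℕ.* (n ℕ.+ 3 ℕ.* o ℕ.+ 7) ℕ.+ 2
                       ≡ suc (m ℕ.* n ℕ.+ 2 ℕ.* m ℕ.+ 2 ℕ.* n ℕ.+ 2
                              ℕ.+ 3 ℕ.* (m ℕ.* o ℕ.+ 2 ℕ.* m ℕ.+ 2 ℕ.* o ℕ.+ 2) ℕ.+ 7 ℕ.+ m)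
  identity = solve-∀

1+m<[1+[m⊕0]]⊕0 : ∀ m → suc m < suc (m ⊕ 0) ⊕ 0
1+m<[1+[m⊕0]]⊕0 m = n≡1+m+k⇒m<n 13 (identity m)
  where
  identity : ∀ m → suc (m ℕ.+ 3 ℕ.* 0 ℕ.+ 7) ℕ.+ 3 ℕ.* 0 ℕ.+ 7 ≡ suc (suc m ℕ.+ 13)
  identity = solve-∀

1+[1+m⊕n]<m⊕[1+n] : ∀ m n → suc (suc m ⊕ n) < m ⊕ suc n
1+[1+m⊕n]<m⊕[1+n] m n = n≡1+m+k⇒m<n 0 (identity m n)
  where
  identity : ∀ m n → m ℕ.+ 3 ℕ.* suc n ℕ.+ 7 ≡ suc (suc (suc m ℕ.+ 3 ℕ.* n ℕ.+ 7) ℕ.+ 0)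
  identity = solve-∀

1+m⊗n<m⊗[1+n] : ∀ m n → suc (m ⊗ n) < m ⊗ suc n
1+m⊗n<m⊗[1+n] m n = n≡1+m+k⇒m<n m (identity m n)
  where
  identity : ∀ m n → m ℕ.* suc n ℕ.+ 2 ℕ.* m ℕ.+ 2 ℕ.* suc n ℕ.+ 2
                     ≡ suc (suc (m ℕ.* n ℕ.+ 2 ℕ.* m ℕ.+ 2 ℕ.* n ℕ.+ 2) ℕ.+ m)
  identity = solve-∀

↦-decreases-weight : {V : Set} {s t : Term V} → s ↦ t → weight t < weight s
↦-decreases-weight (R1 x)     = m<m⊕0 (weight x)
↦-decreases-weight (R2 x)     = m<0⊕m (weight x)
↦-decreases-weight (R3 x y z) = [m⊕n]⊕o<m⊕[n⊕o] (weight x) (weight y) (weight z)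
↦-decreases-weight (R4 x)     = ℕ.≤-<-trans ℕ.z≤n (m<m⊗0 (weight x))
↦-decreases-weight (R5 x)     = m<m⊗0 (weight x)
↦-decreases-weight (R6 x y z) = m⊗n⊕m⊗o<m⊗[n⊕o] (weight x) (weight y) (weight z)
↦-decreases-weight R7         = z<s
↦-decreases-weight R8         = z<s
↦-decreases-weight (R9 x)     = 1+m<[1+[m⊕0]]⊕0 (weight x)
↦-decreases-weight (R10 x)    = ℕ.m<n⇒m<1+n (ℕ.n<1+n (weight x))
↦-decreases-weight (R11 x y)  = 1+[1+m⊕n]<m⊕[1+n] (weight x) (weight y)
↦-decreases-weight (R12 x y)  = 1+m⊗n<m⊗[1+n] (weight x) (weight y)

⟶-decreases-weight : {V : Set} {s t : Term V} → s ⟶ t → weight t < weight s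
⟶-decreases-weight (root r) = ↦-decreases-weight r
⟶-decreases-weight (neg p)  = s≤s (⟶-decreases-weight p)
⟶-decreases-weight (+ˡ u p) = ⊕-monoˡ-< (weight u) (⟶-decreases-weight p)
⟶-decreases-weight (+ʳ u p) = ⊕-monoʳ-< (weight u) (⟶-decreases-weight p)
⟶-decreases-weight (·ˡ u p) = ⊗-monoˡ-< (weight u) (⟶-decreases-weight p)
⟶-decreases-weight (·ʳ u p) = ⊗-monoʳ-< (weight u) (⟶-decreases-weight p)

stronglyTerminating : StronglyTerminating
stronglyTerminating V =
  Subrelation.wellFounded ⟶-decreases-weight (On.wellFounded weight <-wellFounded)

module _ {V : Set} where

  neg* : {s t : Term V} → s ⟶* t → - s ⟶* - t
  neg* = gmap -_ neg

  +ˡ* : {s t : Term V} (u : Term V) → s ⟶* t → s + u ⟶* t + u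
  +ˡ* u = gmap (_+ u) (+ˡ u)

  +ʳ* : {s t : Term V} (u : Term V) → s ⟶* t → u + s ⟶* u + t
  +ʳ* u = gmap (u +_) (+ʳ u)

  ·ˡ* : {s t : Term V} (u : Term V) → s ⟶* t → s · u ⟶* t · u
  ·ˡ* u = gmap (_· u) (·ˡ u)

  ·ʳ* : {s t : Term V} (u : Term V) → s ⟶* t → u · s ⟶* u · t
  ·ʳ* u = gmap (u ·_) (·ʳ u)

-- numeral⁺ k is the positive numeral of value 1 + k.
numeral⁺ : ℕ → Closed
numeral⁺ zero    = `1
numeral⁺ (suc k) = numeral⁺ k + `1

numeral : ℤ → Closed
numeral +0       = `0
numeral +[1+ k ] = numeral⁺ k
numeral -[1+ k ] = - numeral⁺ k

eval : Closed → ℤ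
eval `0      = 0ℤ
eval `1      = 1ℤ
eval (- t)   = ℤ.- eval t
eval (s + t) = eval s ℤ.+ eval t
eval (s · t) = eval s ℤ.* eval t

↦-preserves-eval : {s t : Closed} → s ↦ t → eval s ≡ eval t
↦-preserves-eval (R1 x)     = ℤ.+-identityʳ (eval x)
↦-preserves-eval (R2 x)     = ℤ.+-identityˡ (eval x)
↦-preserves-eval (R3 x y z) = sym (ℤ.+-assoc (eval x) (eval y) (eval z))
↦-preserves-eval (R4 x)     = ℤ.*-zeroʳ (eval x)
↦-preserves-eval (R5 x)     = ℤ.*-identityʳ (eval x)
↦-preserves-eval (R6 x y z) = ℤ.*-distribˡ-+ (eval x) (eval y) (eval z)
↦-preserves-eval R7         = refl
↦-preserves-eval R8         = refl
↦-preserves-eval (R9 x)     = identity (eval x)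
  where
  identity : ∀ i → ℤ.- (i ℤ.+ 1ℤ) ℤ.+ 1ℤ ≡ ℤ.- i
  identity = ℤ-Solver.solve-∀
↦-preserves-eval (R10 x)    = ℤ.neg-involutive (eval x)
↦-preserves-eval (R11 x y)  = identity (eval x) (eval y)
  where
  identity : ∀ i j → i ℤ.+ ℤ.- j ≡ ℤ.- (ℤ.- i ℤ.+ j)
  identity = ℤ-Solver.solve-∀
↦-preserves-eval (R12 x y)  = sym (ℤ.neg-distribʳ-* (eval x) (eval y))

⟶-preserves-eval : {s t : Closed} → s ⟶ t → eval s ≡ eval t
⟶-preserves-eval (root r) = ↦-preserves-eval r
⟶-preserves-eval (neg p)  = cong ℤ.-_ (⟶-preserves-eval p)
⟶-preserves-eval (+ˡ u p) = cong (ℤ._+ eval u) (⟶-preserves-eval p)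
⟶-preserves-eval (+ʳ u p) = cong (ℤ._+_ (eval u)) (⟶-preserves-eval p)
⟶-preserves-eval (·ˡ u p) = cong (ℤ._* eval u) (⟶-preserves-eval p)
⟶-preserves-eval (·ʳ u p) = cong (eval u ℤ.*_) (⟶-preserves-eval p)

⟶*-preserves-eval : {s t : Closed} → s ⟶* t → eval s ≡ eval t
⟶*-preserves-eval ε        = refl
⟶*-preserves-eval (p ◅ ps) = trans (⟶-preserves-eval p) (⟶*-preserves-eval ps)

open StarReasoning (_⟶_ {⊥})

neg-numeral : ∀ z → - numeral z ⟶* numeral (ℤ.- z)
neg-numeral +0       = root R7 ◅ ε
neg-numeral +[1+ k ] = ε
neg-numeral -[1+ k ] = root (R10 _) ◅ ε

suc-numeral : ∀ z → numeral z + `1 ⟶* numeral (ℤ.suc z)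
suc-numeral +0           = root (R2 _) ◅ ε
suc-numeral +[1+ k ]     = ε
suc-numeral -[1+ zero ]  = root R8 ◅ ε
suc-numeral -[1+ suc k ] = root (R9 _) ◅ ε

+-numeral⁺ : ∀ z k → numeral z + numeral⁺ k ⟶* numeral (z ℤ.+ +[1+ k ])
+-numeral⁺ z zero = begin
  numeral z + `1                 ⟶*⟨ suc-numeral z ⟩
  numeral (1ℤ ℤ.+ z)             ≡⟨ cong numeral (ℤ.+-comm 1ℤ z) ⟩
  numeral (z ℤ.+ 1ℤ)             ∎
+-numeral⁺ z (suc k) = begin
  numeral z + (numeral⁺ k + `1)       ⟶⟨ root (R3 _ _ _) ⟩
  numeral z + numeral⁺ k + `1         ⟶*⟨ +ˡ* `1 (+-numeral⁺ z k) ⟩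
  numeral (z ℤ.+ +[1+ k ]) + `1       ⟶*⟨ suc-numeral (z ℤ.+ +[1+ k ]) ⟩
  numeral (1ℤ ℤ.+ (z ℤ.+ +[1+ k ]))   ≡⟨ cong numeral (identity z +[1+ k ]) ⟩
  numeral (z ℤ.+ +[1+ suc k ])        ∎
  where
  identity : ∀ i j → 1ℤ ℤ.+ (i ℤ.+ j) ≡ i ℤ.+ (1ℤ ℤ.+ j)
  identity = ℤ-Solver.solve-∀

+-numeral : ∀ z w → numeral z + numeral w ⟶* numeral (z ℤ.+ w)
+-numeral z +0 = begin
  numeral z + `0         ⟶⟨ root (R1 _) ⟩
  numeral z              ≡⟨ cong numeral (sym (ℤ.+-identityʳ z)) ⟩
  numeral (z ℤ.+ 0ℤ)     ∎
+-numeral z +[1+ k ] = +-numeral⁺ z k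
+-numeral z -[1+ k ] = begin
  numeral z + - numeral⁺ k                  ⟶⟨ root (R11 _ _) ⟩
  - (- numeral z + numeral⁺ k)              ⟶*⟨ neg* (+ˡ* _ (neg-numeral z)) ⟩
  - (numeral (ℤ.- z) + numeral⁺ k)          ⟶*⟨ neg* (+-numeral⁺ (ℤ.- z) k) ⟩
  - numeral (ℤ.- z ℤ.+ +[1+ k ])            ⟶*⟨ neg-numeral (ℤ.- z ℤ.+ +[1+ k ]) ⟩
  numeral (ℤ.- (ℤ.- z ℤ.+ +[1+ k ]))        ≡⟨ cong numeral (identity z +[1+ k ]) ⟩
  numeral (z ℤ.+ -[1+ k ])                  ∎
  where
  identity : ∀ i j → ℤ.- (ℤ.- i ℤ.+ j) ≡ i ℤ.+ ℤ.- j
  identity = ℤ-Solver.solve-∀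

·-numeral⁺ : ∀ z k → numeral z · numeral⁺ k ⟶* numeral (z ℤ.* +[1+ k ])
·-numeral⁺ z zero = begin
  numeral z · `1          ⟶⟨ root (R5 _) ⟩
  numeral z               ≡⟨ cong numeral (sym (ℤ.*-identityʳ z)) ⟩
  numeral (z ℤ.* 1ℤ)      ∎
·-numeral⁺ z (suc k) = begin
  numeral z · (numeral⁺ k + `1)                 ⟶⟨ root (R6 _ _ _) ⟩
  numeral z · numeral⁺ k + numeral z · `1       ⟶*⟨ +ˡ* _ (·-numeral⁺ z k) ⟩
  numeral (z ℤ.* +[1+ k ]) + numeral z · `1     ⟶⟨ +ʳ _ (root (R5 _)) ⟩
  numeral (z ℤ.* +[1+ k ]) + numeral z          ⟶*⟨ +-numeral (z ℤ.* +[1+ k ]) z ⟩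
  numeral (z ℤ.* +[1+ k ] ℤ.+ z)                ≡⟨ cong numeral (identity z +[1+ k ]) ⟩
  numeral (z ℤ.* +[1+ suc k ])                  ∎
  where
  identity : ∀ i j → i ℤ.* j ℤ.+ i ≡ i ℤ.* (1ℤ ℤ.+ j)
  identity = ℤ-Solver.solve-∀

·-numeral : ∀ z w → numeral z · numeral w ⟶* numeral (z ℤ.* w)
·-numeral z +0 = begin
  numeral z · `0          ⟶⟨ root (R4 _) ⟩
  `0                      ≡⟨ cong numeral (sym (ℤ.*-zeroʳ z)) ⟩
  numeral (z ℤ.* 0ℤ)      ∎
·-numeral z +[1+ k ] = ·-numeral⁺ z k
·-numeral z -[1+ k ] = begin
  numeral z · - numeral⁺ k                ⟶⟨ root (R12 _ _) ⟩
  - (numeral z · numeral⁺ k)              ⟶*⟨ neg* (·-numeral⁺ z k) ⟩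
  - numeral (z ℤ.* +[1+ k ])              ⟶*⟨ neg-numeral (z ℤ.* +[1+ k ]) ⟩
  numeral (ℤ.- (z ℤ.* +[1+ k ]))          ≡⟨ cong numeral (ℤ.neg-distribʳ-* z +[1+ k ]) ⟩
  numeral (z ℤ.* -[1+ k ])                ∎

⟶*-numeral-eval : ∀ t → t ⟶* numeral (eval t)
⟶*-numeral-eval `0 = ε
⟶*-numeral-eval `1 = ε
⟶*-numeral-eval (- t) = begin
  - t                                  ⟶*⟨ neg* (⟶*-numeral-eval t) ⟩
  - numeral (eval t)                   ⟶*⟨ neg-numeral (eval t) ⟩
  numeral (ℤ.- eval t)                 ∎
⟶*-numeral-eval (s + t) = begin
  s + t                                ⟶*⟨ +ˡ* t (⟶*-numeral-eval s) ⟩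
  numeral (eval s) + t                 ⟶*⟨ +ʳ* _ (⟶*-numeral-eval t) ⟩
  numeral (eval s) + numeral (eval t)  ⟶*⟨ +-numeral (eval s) (eval t) ⟩
  numeral (eval s ℤ.+ eval t)          ∎
⟶*-numeral-eval (s · t) = begin
  s · t                                ⟶*⟨ ·ˡ* t (⟶*-numeral-eval s) ⟩
  numeral (eval s) · t                 ⟶*⟨ ·ʳ* _ (⟶*-numeral-eval t) ⟩
  numeral (eval s) · numeral (eval t)  ⟶*⟨ ·-numeral (eval s) (eval t) ⟩
  numeral (eval s ℤ.* eval t)          ∎

groundConfluent : GroundConfluent
groundConfluent t u v t⟶*u t⟶*v = numeral (eval u) , ⟶*-numeral-eval u , v⟶*numeral
  where
  v⟶*numeral : v ⟶* numeral (eval u)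
  v⟶*numeral = begin
    v                  ⟶*⟨ ⟶*-numeral-eval v ⟩
    numeral (eval v)   ≡⟨ cong numeral (sym (⟶*-preserves-eval t⟶*v)) ⟩
    numeral (eval t)   ≡⟨ cong numeral (⟶*-preserves-eval t⟶*u) ⟩
    numeral (eval u)   ∎

theorem2p1p2 : GroundComplete
theorem2p1p2 = stronglyTerminating , groundConfluent
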